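{- Let $F$ be a Boolean circuit, $(T,\mathbf{G})$ a type-respecting simplified clique decomposition of $F$, and $F^*$ the circuit constructed from them as in the context. For each original gate $g$ of $F^*$ that is a NOT gate, $f(g,F^*)$ is the negation of $f(g',F^*)$, where $g'$ is the input of $g$ in $F$.
   Context: Boolean circuits over $\{\vee,\wedge,\neg\}$ (input gates, NOT gates with one input, AND/OR gates with positive fan-in, no constants). Labeled directed graph $(V,E,\mathbf{S})$: $\mathbf{S}$ a partition of $V$ into labels. Simplified clique decomposition (SCD) $(T,\mathbf{G})$: rooted tree, nodes with at most two children, each node $t$ carrying $G(t)$; leaf: $(\{v\},\emptyset,\{\{v\}\})$; two children: union of vertex-disjoint graphs; one child $t_1$: $G(t_1)$ modified by adding a new vertex as a singleton label, by union of two labels $S_1,S_2$ into $S$ ($S_1,S_2$ children of $S$), or by adding all arcs from label $S_1$ to label $S_2$ ("arc from $S_1$ to $S_2$"). It is an SCD of $F$ if the unlabeled root graph is the DAG of $F$; type-respecting if every non-singleton label is unary (input/NOT gates only), AND (AND gates only) or OR (OR gates only); singleton labels take the type of their gate. Construction of $F^*$: singleton $\{g\}$ gives original gate $g$ with $oand=oor=in=g$; non-singleton $S$ gets AND gate $oand(S)$, OR gate $oor(S)$, and if $S$ has no input gates a gate $in(S)$ (AND for AND labels, OR for OR labels, two chained NOT gates for unary labels). Wires: $oand(S_1)\to oand(S_2)$, $oor(S_1)\to oor(S_2)$ when $S_1$ is a child of $S_2$; $in(S_2)\to in(S_1)$ when $S_1$ is a child of $S_2$ and $S_2$ has no input gates;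 for each arc from $S_1$ to $S_2$: $oand(S_1)\to in(S_2)$ if $S_2$ is an AND label, $oor(S_1)\to in(S_2)$ if an OR label, one arbitrary of $oand(S_1),oor(S_1)$ to $in(S_2)$ if $S_2$ is a unary label of NOT gates only. Finally $in(S)$ gates without inputs are iteratively removed. $F^*$ is acyclic, and for a gate $g$ of $F^*$, $f(g,F^*)$ denotes the Boolean function of the input variables computed at the output of $g$ in $F^*$. -}

module Defs where

open import Data.Nat using (ℕ; zero; suc; _+_; _*_)
open import Data.Bool using (Bool; true; false; not; if_then_else_)
open import Data.Bool.Properties renaming (_≟_ to _≟ᵇ_)
open import Data.Fin using (Fin)
open import Data.Fin.Subset using (Subset; ⁅_⁆; _∪_; _∈_; _∉_)
open import Data.Fin.Subset.Properties using (_∈?_)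
open import Data.List using (List; []; _∷_; _++_; map; concatMap; filterᵇ; allFin; length; filter)
open import Data.Bool.ListAction using (and; or; any)
open import Data.List.Membership.Propositional using () renaming (_∈_ to _∈ˡ_)
open import Data.Product using (Σ; ∃; ∃-syntax; _×_; _,_; proj₁; proj₂)
open import Data.Sum using (_⊎_)
open import Data.Unit using (⊤)
open import Data.Empty using (⊥)
open import Data.Vec.Properties using (≡-dec)
open import Relation.Nullary using (¬_; Dec; yes; no)
open import Relation.Nullary.Decidable using (⌊_⌋)
open import Relation.Binary.PropositionalEquality using (_≡_; _≢_)
open import Relation.Binary.Construct.Closure.Transitive using (TransClosure)
open import Function.Bundles using (_⇔_)

data Kind : Set where
  inputK notK andK orK : Kind

record Circuit (n : ℕ) : Set₁ where
  field
    kind : Fin n → Kind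
    wire : Fin n → Fin n → Set      -- wire u v : arc from gate u to gate v

open Circuit public

record IsCircuit {n : ℕ} (F : Circuit n) : Set where
  field
    acyclic   : ∀ v → ¬ TransClosure (wire F) v v
    inputNoIn : ∀ u v → wire F u v → kind F v ≢ inputK
    notOneIn  : ∀ v → kind F v ≡ notK →
                ∃[ u ] (wire F u v × (∀ w → wire F w v → w ≡ u))
    andPosIn  : ∀ v → kind F v ≡ andK → ∃[ u ] wire F u v
    orPosIn   : ∀ v → kind F v ≡ orK → ∃[ u ] wire F u v

-- Simplified clique decompositions, as terms.  Since (in a valid
-- decomposition) distinct labels of the label forest have distinct vertex
-- sets, a label is named by its vertex set (a Subset n).

data SCD (n : ℕ) : Set where
  leaf  : Fin n → SCD n                        -- ({v}, ∅, {{v}})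
  union : SCD n → SCD n → SCD n
  add   : Fin n → SCD n → SCD n                -- add new vertex as singleton label
  merge : Subset n → Subset n → SCD n → SCD n  -- union of labels S₁,S₂ into S₁ ∪ S₂
  arcs  : Subset n → Subset n → SCD n → SCD n  -- all arcs from label S₁ to label S₂

module _ {n : ℕ} where

  _≟ˢ_ : (S T : Subset n) → Dec (S ≡ T)
  _≟ˢ_ = ≡-dec _≟ᵇ_

  _==ˢ_ : Subset n → Subset n → Bool
  S ==ˢ T = ⌊ S ≟ˢ T ⌋

  verts : SCD n → Subset n
  verts (leaf v)      = ⁅ v ⁆
  verts (union t₁ t₂) = verts t₁ ∪ verts t₂
  verts (add v t)     = ⁅ v ⁆ ∪ verts t
  verts (merge _ _ t) = verts t
  verts (arcs _ _ t)  = verts t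

  labels : SCD n → List (Subset n)
  labels (leaf v)        = ⁅ v ⁆ ∷ []
  labels (union t₁ t₂)   = labels t₁ ++ labels t₂
  labels (add v t)       = ⁅ v ⁆ ∷ labels t
  labels (merge S₁ S₂ t) =
    (S₁ ∪ S₂) ∷ filterᵇ (λ S → not (S ==ˢ S₁) Data.Bool.∧ not (S ==ˢ S₂)) (labels t)
  labels (arcs _ _ t)    = labels t

  WF : SCD n → Set
  WF (leaf v)        = ⊤
  WF (union t₁ t₂)   = WF t₁ × WF t₂ × (∀ v → v ∈ verts t₁ → v ∉ verts t₂)
  WF (add v t)       = WF t × v ∉ verts t
  WF (merge S₁ S₂ t) = WF t × S₁ ∈ˡ labels t × S₂ ∈ˡ labels t × S₁ ≢ S₂
  WF (arcs S₁ S₂ t)  = WF t × S₁ ∈ˡ labels t × S₂ ∈ˡ labels t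

  merges : SCD n → List (Subset n × Subset n)
  merges (leaf v)        = []
  merges (union t₁ t₂)   = merges t₁ ++ merges t₂
  merges (add v t)       = merges t
  merges (merge S₁ S₂ t) = (S₁ , S₂) ∷ merges t
  merges (arcs _ _ t)    = merges t

  arcOps : SCD n → List (Subset n × Subset n)
  arcOps (leaf v)        = []
  arcOps (union t₁ t₂)   = arcOps t₁ ++ arcOps t₂
  arcOps (add v t)       = arcOps t
  arcOps (merge _ _ t)   = arcOps t
  arcOps (arcs S₁ S₂ t)  = (S₁ , S₂) ∷ arcOps t

  -- non-singleton labels: exactly the results of label unions
  IsNonSingleton : SCD n → Subset n → Set
  IsNonSingleton t S = ∃[ p ] (p ∈ˡ merges t × proj₁ p ∪ proj₂ p ≡ S)

  rootArc : SCD n → Fin n → Fin n → Set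
  rootArc t u v = ∃[ p ] (p ∈ˡ arcOps t × u ∈ proj₁ p × v ∈ proj₂ p)

data LType : Set where
  unaryT andT orT : LType

ktype : Kind → LType
ktype inputK = unaryT
ktype notK   = unaryT
ktype andK   = andT
ktype orK    = orT

isInput : Kind → Bool
isInput inputK = true
isInput _      = false

module _ {n : ℕ} where

  members : Subset n → List (Fin n)
  members S = filter (_∈? S) (allFin n)

  IsSCDOf : Circuit n → SCD n → Set
  IsSCDOf F t = WF t × (∀ v → v ∈ verts t) × (∀ u v → wire F u v ⇔ rootArc t u v)

  TypeRespecting : Circuit n → SCD n → Set
  TypeRespecting F t = ∀ S → IsNonSingleton t S →
    ∀ u v → u ∈ S → v ∈ S → ktype (kind F u) ≡ ktype (kind F v)

data Gate* (n : ℕ) : Set where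
  orig : Fin n → Gate* n        -- original gate g (= oand/oor/in of {g})
  oand : Subset n → Gate* n
  oor  : Subset n → Gate* n
  inA  : Subset n → Gate* n     -- in(S) (AND/OR labels), or first NOT of in(S) (unary labels)
  inB  : Subset n → Gate* n     -- second NOT of in(S) (unary labels)

data Op (n : ℕ) : Set where
  opIn  : Fin n → Op n
  opNot opAnd opOr : Op n

-- The construction.  'choice S₁ S₂' is the arbitrary choice made for an arc
-- from S₁ to a unary label S₂ (true: use oand(S₁), false: use oor(S₁)).
module Construction {n : ℕ} (F : Circuit n) (t : SCD n)
                    (choice : Subset n → Subset n → Bool) where

  stype : Subset n → LType
  stype S with members S
  ... | []    = unaryT
  ... | v ∷ _ = ktype (kind F v)

  hasInputGate : Subset n → Bool
  hasInputGate S = any (λ v → isInput (kind F v)) (members S)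

  -- gates oand(S), oor(S), in(S) (receiving end) and in(S) (output end);
  -- for a singleton label {g} they are all the original gate g.
  oandG oorG inOut : Subset n → Gate* n
  oandG S with members S
  ... | v ∷ [] = orig v
  ... | _      = oand S
  oorG S with members S
  ... | v ∷ [] = orig v
  ... | _      = oor S
  inOut S with members S
  ... | v ∷ [] = orig v
  ... | _      with stype S
  ...   | unaryT = inB S
  ...   | _      = inA S

  childPairs : List (Subset n × Subset n)   -- (child , parent)
  childPairs = concatMap (λ p → (proj₁ p , proj₁ p ∪ proj₂ p)
                                ∷ (proj₂ p , proj₁ p ∪ proj₂ p) ∷ []) (merges t)

  children parents arcsInto : Subset n → List (Subset n)
  children S = map proj₁ (filterᵇ (λ p → proj₂ p ==ˢ S) childPairs)
  parents  S = map proj₂ (filterᵇ (λ p → proj₁ p ==ˢ S) childPairs)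
  arcsInto S = map proj₁ (filterᵇ (λ p → proj₂ p ==ˢ S) (arcOps t))

  source : Subset n → Subset n → Gate* n
  source S₁ S₂ with stype S₂
  ... | andT   = oandG S₁
  ... | orT    = oorG S₁
  ... | unaryT = if choice S₁ S₂ then oandG S₁ else oorG S₁

  inInputs : Subset n → List (Gate* n)
  inInputs S = map inOut (filterᵇ (λ P → not (hasInputGate P)) (parents S))
               ++ map (λ S₁ → source S₁ S) (arcsInto S)

  -- inputs of each gate (before removal of input-less in(S) gates)
  inputs : Gate* n → List (Gate* n)
  inputs (orig v) = inInputs ⁅ v ⁆
  inputs (oand S) = map oandG (children S)
  inputs (oor S)  = map oorG (children S)
  inputs (inA S)  = inInputs S
  inputs (inB S)  = inA S ∷ []

  op : Gate* n → Op n
  op (orig v) with kind F v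
  ... | inputK = opIn v
  ... | notK   = opNot
  ... | andK   = opAnd
  ... | orK    = opOr
  op (oand S) = opAnd
  op (oor S)  = opOr
  op (inA S) with stype S
  ... | unaryT = opNot
  ... | andT   = opAnd
  ... | orT    = opOr
  op (inB S)  = opNot

  -- upper bound on the number of gates of F* (n originals, ≤ 4 per non-singleton label)
  bound : ℕ
  bound = n + 4 * length (merges t)

  -- iterative removal of in(S) gates without inputs: after k rounds
  present : ℕ → Gate* n → Bool
  present zero    _       = true
  present (suc k) (inA S) = any (present k) (inputs (inA S))
  present (suc k) (inB S) = any (present k) (inputs (inB S))
  present (suc k) _       = true

  alive : Gate* n → Bool
  alive = present bound

  inputs* : Gate* n → List (Gate* n)
  inputs* g = filterᵇ alive (inputs g)

  apply : (Fin n → Bool) → Op n → List Bool → Bool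
  apply ρ (opIn v) _  = ρ v
  apply ρ opNot    bs = not (and bs)   -- = negation of the unique input
  apply ρ opAnd    bs = and bs
  apply ρ opOr     bs = or bs

  eval : (Fin n → Bool) → ℕ → Gate* n → Bool
  eval ρ zero    _ = false
  eval ρ (suc k) g = apply ρ (op g) (map (eval ρ k) (inputs* g))

  f : Gate* n → (Fin n → Bool) → Bool
  f g ρ = eval ρ bound g

module Submission where

-- f evaluates F* with a fuel of `bound` steps, so we first show that this fuel suffices.
-- Acyclicity: a lexicographic potential made from the ranks strictly decreases from a
-- built gate to each of its inputs, so paths of F* below a built gate have at most
-- `bound` gates.  Equations: hence f and the removal of input-less in-gates satisfy
-- the gate equations of F*.
--
-- NotGate: every union containing g is a unary label, and every arc into a label
-- containing g comes from {g′}.  By induction upwards along ⊃, each alive in(P) with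
-- g ∈ P computes ¬ f(g′), so every live input of g computes f(g′); by induction
-- downwards along ⊂, starting from the arc g′ → g, g has a live input.

open import Defs
open import Data.Nat using (ℕ)
open import Data.Bool using (Bool; not)
open import Data.Fin using (Fin)
open import Data.Fin.Subset using (Subset)
open import Relation.Binary.PropositionalEquality using (_≡_)

open import Data.Nat using (zero; suc; pred; _+_; _*_; _≤_; _<_; z≤n; s≤s)
open import Data.Nat.Properties
  using (≤-refl; ≤-reflexive; ≤-trans; <-trans; ≤-<-trans; <-≤-trans; <-irrefl; +-suc; *-suc; *-monoʳ-≤;
         n<1+n; m≤n⇒m<n∨m≡n; 1+n≰n; module ≤-Reasoning) renaming (_≟_ to _≟ⁿ_)
open import Data.Bool using (true; false; T; T?; _∧_; _∨_)
open import Data.Bool.Properties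
  using (∧-identityʳ; ∧-idem; ∨-identityʳ; not-involutive; T-not-≡) renaming (_≟_ to _≟ᵇ_)
open import Data.Bool.ListAction using (and; or; any)
open import Data.Empty using (⊥; ⊥-elim)
open import Data.Fin.Subset using (⁅_⁆; _∪_; _∈_; _∉_; _⊆_; _⊂_; _⊃_; ∁; Nonempty; ∣_∣)
open import Data.Fin.Subset.Properties
  using (_∈?_; x∈⁅x⁆; x∈⁅y⁆⇒x≡y; x∈p∪q⁻; x∈p∪q⁺; ⊆-antisym; p⊂q⇒∣p∣<∣q∣; p⊂q⇒∁p⊃∁q)
open import Data.Fin.Subset.Induction using (Acc; acc; ⊂-wellFounded; ⊃-wellFounded)
open import Data.List using (List; []; _∷_; _++_; map; filter; filterᵇ; length; allFin; concatMap)
open import Data.List.Extrema.Nat using (max; min; xs≤max; max<v⁺; max-mono-⊆; min≤xs; v<min⁺; v≤min⁺)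
open import Data.List.Properties using (length-++; length-map; length-tabulate; map-cong-local)
open import Data.List.Membership.Propositional using (find; lose) renaming (_∈_ to _∈ˡ_)
open import Data.List.Membership.Propositional.Properties
  using (∈-filter⁺; ∈-filter⁻; ∈-allFin; ∈-map⁺; ∈-map⁻; ∈-++⁺ˡ; ∈-++⁺ʳ; ∈-++⁻; ∈-∃++;
         ∈-concatMap⁺; ∈-concatMap⁻)
open import Data.List.Relation.Unary.Any as Any using (Any; here; there; any?)
open import Data.List.Relation.Unary.Any.Properties using (any⁺; any⁻)
open import Data.List.Relation.Unary.All as All using (All; []; _∷_; all?)
open import Data.List.Relation.Unary.All.Properties
  using (¬All⇒Any¬) renaming (map⁺ to All-map⁺; ++⁺ to All-++⁺; filter⁺ to All-filter⁺)
open import Data.List.Relation.Unary.AllPairs as AllPairs using ([]; _∷_)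
open import Data.List.Relation.Unary.Linked as Linked using (Linked; [-]; _∷_)
open import Data.List.Relation.Unary.Linked.Properties using (Linked⇒AllPairs)
open import Data.List.Relation.Unary.Unique.Propositional using (Unique)
import Data.List.Relation.Unary.Unique.Propositional.Properties as Unique
open import Data.Product using (∃; ∃-syntax; _×_; _,_; proj₁; proj₂)
open import Data.Product.Relation.Binary.Lex.Strict using (×-Lex; ×-transitive)
open import Data.Sum using (_⊎_; inj₁; inj₂; [_,_]′)
open import Data.Unit using (⊤; tt)
open import Level using (0ℓ)
open import Function using (_∘_; Equivalence)
open import Relation.Binary using (Rel; Transitive; DecidableEquality)
open import Relation.Binary.PropositionalEquality
  using (_≢_; refl; sym; trans; cong; cong₂; subst; isEquivalence; resp₂; module ≡-Reasoning)
open import Relation.Binary.Construct.Closure.Transitive using (TransClosure; [_]) renaming (_++_ to _++⁺_)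
open import Relation.Nullary using (¬_; Dec; yes; no)
open import Relation.Nullary.Decidable using (toWitness; fromWitness; map′; _×-dec_)

module ListFacts {A : Set} where

  ∈-filterᵇ⁺ : ∀ (p : A → Bool) {x xs} → x ∈ˡ xs → T (p x) → x ∈ˡ filterᵇ p xs
  ∈-filterᵇ⁺ p = ∈-filter⁺ (T? ∘ p)

  ∈-filterᵇ⁻ : ∀ (p : A → Bool) {x xs} → x ∈ˡ filterᵇ p xs → x ∈ˡ xs × T (p x)
  ∈-filterᵇ⁻ p = ∈-filter⁻ (T? ∘ p)

  unique-singleton : ∀ {x : A} {xs} → Unique xs → x ∈ˡ xs → (∀ {y} → y ∈ˡ xs → y ≡ x) → xs ≡ x ∷ []
  unique-singleton {xs = y ∷ []}       _              (here refl) _    = refl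
  unique-singleton {xs = y ∷ []}       _              (there ())  _
  unique-singleton {xs = y ∷ z ∷ zs} ((y≢z ∷ _) ∷ _) _           only =
    ⊥-elim (y≢z (trans (only (here refl)) (sym (only (there (here refl))))))

  two-entries : ∀ {x y : A} {xs} → x ∈ˡ xs → y ∈ˡ xs → x ≢ y → ∃[ a ] ∃[ b ] ∃[ rest ] (xs ≡ a ∷ b ∷ rest)
  two-entries {xs = a ∷ b ∷ rest} _           _           _   = a , b , rest , refl
  two-entries {xs = a ∷ []}       (here refl) (here refl) x≢y = ⊥-elim (x≢y refl)

  unique-length≤ : ∀ {xs ys : List A} → Unique xs → (∀ {z} → z ∈ˡ xs → z ∈ˡ ys) → length xs ≤ length ys
  unique-length≤ {[]}     _            _  = z≤n
  unique-length≤ {x ∷ xs} (x∉xs ∷ uxs) xs⊆ys with ∈-∃++ (xs⊆ys (here refl))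
  ... | as , bs , refl = begin
      suc (length xs)            ≤⟨ s≤s (unique-length≤ uxs (λ z∈ → remove (xs⊆ys (there z∈)) (x≢ z∈))) ⟩
      suc (length (as ++ bs))    ≡⟨ cong suc (length-++ as) ⟩
      suc (length as + length bs) ≡⟨ sym (+-suc (length as) (length bs)) ⟩
      length as + length (x ∷ bs) ≡⟨ sym (length-++ as) ⟩
      length (as ++ x ∷ bs)      ∎
    where
    open ≤-Reasoning
    x≢ : ∀ {z} → z ∈ˡ xs → z ≢ x
    x≢ z∈ refl = All.lookup x∉xs z∈ refl
    remove : ∀ {z} → z ∈ˡ as ++ x ∷ bs → z ≢ x → z ∈ˡ as ++ bs
    remove z∈ z≢x with ∈-++⁻ as z∈
    ... | inj₁ z∈as         = ∈-++⁺ˡ z∈as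
    ... | inj₂ (here refl)  = ⊥-elim (z≢x refl)
    ... | inj₂ (there z∈bs) = ∈-++⁺ʳ as z∈bs

  -- A chain in a strict order never repeats an element, so it is at most as long
  -- as any list containing all of its elements.
  chain-length≤ : ∀ {R : Rel A 0ℓ} → Transitive R → (∀ {x} → ¬ R x x) →
                  ∀ {xs ys} → Linked R xs → (∀ {z} → z ∈ˡ xs → z ∈ˡ ys) → length xs ≤ length ys
  chain-length≤ R-trans R-irrefl chain =
    unique-length≤ (AllPairs.map (λ { Rxy refl → R-irrefl Rxy }) (Linked⇒AllPairs R-trans chain))

  and-constant : ∀ (h : A → Bool) {c ys} → (∀ {y} → y ∈ˡ ys → h y ≡ c) → ∃[ y ] y ∈ˡ ys → and (map h ys) ≡ c
  and-constant h {ys = []}         _     (_ , ())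
  and-constant h {c} {y ∷ []}      all-c _ = trans (∧-identityʳ (h y)) (all-c (here refl))
  and-constant h {c} {y ∷ y′ ∷ ys} all-c _ =
    trans (cong₂ _∧_ (all-c (here refl)) (and-constant h (all-c ∘ there) (y′ , here refl))) (∧-idem c)

open ListFacts

-- An iteration  iter (k+1) x = step x (values of iter k below x)  is stable at x
-- once the fuel k exceeds the length of every path below x.
module Iteration {A B : Set} (_≟_ : DecidableEquality B) (next : A → List A)
                 (step : A → List B → B) (iter : ℕ → A → B)
                 (iter-suc : ∀ k x → iter (suc k) x ≡ step x (map (iter k) (next x))) where

  Next : Rel A 0ℓ
  Next x y = y ∈ˡ next x

  unstable⇒path : ∀ k x → iter k x ≢ iter (suc k) x → ∃[ xs ] (Linked Next (x ∷ xs) × length xs ≡ k)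
  unstable⇒path zero    x _      = [] , [-] , refl
  unstable⇒path (suc k) x differ with all? (λ y → iter k y ≟ iter (suc k) y) (next x)
  ... | yes agree = ⊥-elim (differ (begin
        iter (suc k) x                          ≡⟨ iter-suc k x ⟩
        step x (map (iter k) (next x))          ≡⟨ cong (step x) (map-cong-local agree) ⟩
        step x (map (iter (suc k)) (next x))    ≡⟨ sym (iter-suc (suc k) x) ⟩
        iter (suc (suc k)) x                    ∎))
    where open ≡-Reasoning
  ... | no disagree with find (¬All⇒Any¬ (λ y → iter k y ≟ iter (suc k) y) (next x) disagree)
  ...   | y , y∈ , differ-y with unstable⇒path k y differ-y
  ...     | ys , path , len = y ∷ ys , y∈ ∷ path , cong suc len

  stable : ∀ k x → (∀ {xs} → Linked Next (x ∷ xs) → length xs ≢ k) → iter k x ≡ iter (suc k) x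
  stable k x no-path with iter k x ≟ iter (suc k) x
  ... | yes same = same
  ... | no differ = let _ , path , len = unstable⇒path k x differ in ⊥-elim (no-path path len)

module Decomposition {n : ℕ} where

  Disjoint : Subset n → Subset n → Set
  Disjoint S T = ∀ {x} → x ∈ S → x ∉ T

  -- S is a singleton or the result of a label union of t: exactly the labels
  -- for which F* provides gates.
  Label : SCD n → Subset n → Set
  Label t S = (∃[ v ] S ≡ ⁅ v ⁆) ⊎ IsNonSingleton t S

  Operand : SCD n → Subset n → Set
  Operand t S = Nonempty S × Label t S

  MergeOK : SCD n → Subset n × Subset n → Set
  MergeOK t (S₁ , S₂) = Operand t S₁ × Operand t S₂ × Disjoint S₁ S₂

  ArcOK : SCD n → Subset n × Subset n → Set
  ArcOK t (S₁ , S₂) = Operand t S₁ × Operand t S₂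

  record Sound (t : SCD n) : Set where
    field
      labels-ok       : All (λ S → Operand t S × S ⊆ verts t) (labels t)
      labels-disjoint : ∀ {S T} → S ∈ˡ labels t → T ∈ˡ labels t → S ≡ T ⊎ Disjoint S T
      merges-ok       : All (MergeOK t) (merges t)
      arcs-ok         : All (ArcOK t) (arcOps t)

  record _⊑_ (t u : SCD n) : Set where
    constructor grows
    field more : ∀ {p} → p ∈ˡ merges t → p ∈ˡ merges u

  module _ {t u : SCD n} (t⊑u : t ⊑ u) where
    open _⊑_ t⊑u

    operand-mono : ∀ {S} → Operand t S → Operand u S
    operand-mono (ne , inj₁ single)         = ne , inj₁ single
    operand-mono (ne , inj₂ (p , p∈ , ≡S)) = ne , inj₂ (p , more p∈ , ≡S)

    merge-mono : ∀ {p} → MergeOK t p → MergeOK u p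
    merge-mono (o₁ , o₂ , apart) = operand-mono o₁ , operand-mono o₂ , apart

    arc-mono : ∀ {p} → ArcOK t p → ArcOK u p
    arc-mono (o₁ , o₂) = operand-mono o₁ , operand-mono o₂

  open Sound

  singleton-label : ∀ t v → Operand t ⁅ v ⁆
  singleton-label _ v = (v , x∈⁅x⁆ v) , inj₁ (v , refl)

  sound-leaf : ∀ v → Sound (leaf v)
  sound-leaf v = record
    { labels-ok       = (singleton-label (leaf v) v , (λ x∈ → x∈)) ∷ []
    ; labels-disjoint = λ { (here refl) (here refl) → inj₁ refl }
    ; merges-ok       = []
    ; arcs-ok         = [] }

  sound-union : ∀ {t₁ t₂} → Sound t₁ → Sound t₂ → (∀ v → v ∈ verts t₁ → v ∉ verts t₂) → Sound (union t₁ t₂)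
  sound-union {t₁} {t₂} s₁ s₂ apart = record
    { labels-ok       = All-++⁺ (All.map (lift left (λ x∈ → x∈p∪q⁺ (inj₁ x∈))) (labels-ok s₁))
                                (All.map (lift right (λ x∈ → x∈p∪q⁺ (inj₂ x∈))) (labels-ok s₂))
    ; labels-disjoint = λ S∈ T∈ → disjoint (∈-++⁻ (labels t₁) S∈) (∈-++⁻ (labels t₁) T∈)
    ; merges-ok       = All-++⁺ (All.map (merge-mono left) (merges-ok s₁)) (All.map (merge-mono right) (merges-ok s₂))
    ; arcs-ok         = All-++⁺ (All.map (arc-mono left) (arcs-ok s₁)) (All.map (arc-mono right) (arcs-ok s₂)) }
    where
    left : t₁ ⊑ union t₁ t₂
    left = grows ∈-++⁺ˡ
    right : t₂ ⊑ union t₁ t₂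
    right = grows (∈-++⁺ʳ (merges t₁))
    lift : ∀ {t′ S} → t′ ⊑ union t₁ t₂ → verts t′ ⊆ verts (union t₁ t₂) →
           Operand t′ S × S ⊆ verts t′ → Operand (union t₁ t₂) S × S ⊆ verts (union t₁ t₂)
    lift more grow (o , S⊆) = operand-mono more o , grow ∘ S⊆
    across : ∀ {S T} → S ∈ˡ labels t₁ → T ∈ˡ labels t₂ → Disjoint S T
    across S∈ T∈ x∈S x∈T =
      apart _ (proj₂ (All.lookup (labels-ok s₁) S∈) x∈S) (proj₂ (All.lookup (labels-ok s₂) T∈) x∈T)
    disjoint : ∀ {S T} → S ∈ˡ labels t₁ ⊎ S ∈ˡ labels t₂ → T ∈ˡ labels t₁ ⊎ T ∈ˡ labels t₂ → S ≡ T ⊎ Disjoint S T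
    disjoint (inj₁ S∈) (inj₁ T∈) = labels-disjoint s₁ S∈ T∈
    disjoint (inj₂ S∈) (inj₂ T∈) = labels-disjoint s₂ S∈ T∈
    disjoint (inj₁ S∈) (inj₂ T∈) = inj₂ (across S∈ T∈)
    disjoint (inj₂ S∈) (inj₁ T∈) = inj₂ (λ x∈S x∈T → across T∈ S∈ x∈T x∈S)

  sound-add : ∀ {t v} → Sound t → v ∉ verts t → Sound (add v t)
  sound-add {t} {v} s v∉ = record
    { labels-ok       = (singleton-label t v , (λ x∈ → x∈p∪q⁺ (inj₁ x∈))) ∷ All.map grow (labels-ok s)
    ; labels-disjoint = disjoint
    ; merges-ok       = merges-ok s
    ; arcs-ok         = arcs-ok s }
    where
    grow : ∀ {S} → Operand t S × S ⊆ verts t → Operand t S × S ⊆ verts (add v t)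
    grow (o , S⊆) = o , λ x∈ → x∈p∪q⁺ (inj₂ (S⊆ x∈))
    fresh : ∀ {T} → T ∈ˡ labels t → Disjoint ⁅ v ⁆ T
    fresh T∈ x∈⁅v⁆ x∈T = v∉ (subst (_∈ verts t) (x∈⁅y⁆⇒x≡y v x∈⁅v⁆) (proj₂ (All.lookup (labels-ok s) T∈) x∈T))
    disjoint : ∀ {S T} → S ∈ˡ labels (add v t) → T ∈ˡ labels (add v t) → S ≡ T ⊎ Disjoint S T
    disjoint (here refl) (here refl) = inj₁ refl
    disjoint (here refl) (there T∈)  = inj₂ (fresh T∈)
    disjoint (there S∈)  (here refl) = inj₂ (λ x∈S x∈⁅v⁆ → fresh S∈ x∈⁅v⁆ x∈S)
    disjoint (there S∈)  (there T∈)  = labels-disjoint s S∈ T∈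

  kept-disjoint : ∀ {t S₁ S₂ T} → Sound t → S₁ ∈ˡ labels t → S₂ ∈ˡ labels t →
                  T ∈ˡ filterᵇ (λ S → not (S ==ˢ S₁) ∧ not (S ==ˢ S₂)) (labels t) → Disjoint (S₁ ∪ S₂) T
  kept-disjoint {S₁ = S₁} {S₂} {T} s S₁∈ S₂∈ T∈′ x∈ x∈T
    with ∈-filterᵇ⁻ (λ S → not (S ==ˢ S₁) ∧ not (S ==ˢ S₂)) T∈′
  ... | T∈ , kept with T ≟ˢ S₁ | T ≟ˢ S₂ | x∈p∪q⁻ S₁ S₂ x∈
  ...   | yes _   | _       | _         = kept
  ...   | no _    | yes _   | _         = kept
  ...   | no T≢S₁ | no _    | inj₁ x∈S₁ =
          [ (λ S₁≡T → T≢S₁ (sym S₁≡T)) , (λ apart → apart x∈S₁ x∈T) ]′ (labels-disjoint s S₁∈ T∈)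
  ...   | no _    | no T≢S₂ | inj₂ x∈S₂ =
          [ (λ S₂≡T → T≢S₂ (sym S₂≡T)) , (λ apart → apart x∈S₂ x∈T) ]′ (labels-disjoint s S₂∈ T∈)

  sound-merge : ∀ {t S₁ S₂} → Sound t → S₁ ∈ˡ labels t → S₂ ∈ˡ labels t → S₁ ≢ S₂ → Sound (merge S₁ S₂ t)
  sound-merge {t} {S₁} {S₂} s S₁∈ S₂∈ S₁≢S₂ = record
    { labels-ok       = ((nonempty-∪ , inj₂ ((S₁ , S₂) , here refl , refl)) , ∪⊆)
                        ∷ All-filter⁺ _ (All.map lift (labels-ok s))
    ; labels-disjoint = disjoint
    ; merges-ok       = (operand-mono older o₁ , operand-mono older o₂ , S₁-apart-S₂)
                        ∷ All.map (merge-mono older) (merges-ok s)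
    ; arcs-ok         = All.map (arc-mono older) (arcs-ok s) }
    where
    older : t ⊑ merge S₁ S₂ t
    older = grows there
    lift : ∀ {S} → Operand t S × S ⊆ verts t → Operand (merge S₁ S₂ t) S × S ⊆ verts t
    lift (o , S⊆) = operand-mono older o , S⊆
    o₁ = proj₁ (All.lookup (labels-ok s) S₁∈)
    o₂ = proj₁ (All.lookup (labels-ok s) S₂∈)
    nonempty-∪ : Nonempty (S₁ ∪ S₂)
    nonempty-∪ = let x , x∈ = proj₁ o₁ in x , x∈p∪q⁺ (inj₁ x∈)
    ∪⊆ : S₁ ∪ S₂ ⊆ verts t
    ∪⊆ x∈ = [ proj₂ (All.lookup (labels-ok s) S₁∈) , proj₂ (All.lookup (labels-ok s) S₂∈) ]′ (x∈p∪q⁻ S₁ S₂ x∈)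
    S₁-apart-S₂ : Disjoint S₁ S₂
    S₁-apart-S₂ with labels-disjoint s S₁∈ S₂∈
    ... | inj₁ S₁≡S₂ = ⊥-elim (S₁≢S₂ S₁≡S₂)
    ... | inj₂ apart = apart
    kept = λ {T} → kept-disjoint {T = T} s S₁∈ S₂∈
    disjoint : ∀ {S T} → S ∈ˡ labels (merge S₁ S₂ t) → T ∈ˡ labels (merge S₁ S₂ t) → S ≡ T ⊎ Disjoint S T
    disjoint (here refl) (here refl) = inj₁ refl
    disjoint (here refl) (there T∈)  = inj₂ (kept T∈)
    disjoint (there S∈)  (here refl) = inj₂ (λ x∈S x∈∪ → kept S∈ x∈∪ x∈S)
    disjoint (there S∈)  (there T∈)  = labels-disjoint s (proj₁ (∈-filterᵇ⁻ _ S∈)) (proj₁ (∈-filterᵇ⁻ _ T∈))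

  sound-arcs : ∀ {t S₁ S₂} → Sound t → S₁ ∈ˡ labels t → S₂ ∈ˡ labels t → Sound (arcs S₁ S₂ t)
  sound-arcs s S₁∈ S₂∈ = record
    { labels-ok       = labels-ok s
    ; labels-disjoint = labels-disjoint s
    ; merges-ok       = merges-ok s
    ; arcs-ok         = (proj₁ (All.lookup (labels-ok s) S₁∈) , proj₁ (All.lookup (labels-ok s) S₂∈)) ∷ arcs-ok s }

  sound : ∀ t → WF t → Sound t
  sound (leaf v)        _                           = sound-leaf v
  sound (union t₁ t₂)   (wf₁ , wf₂ , apart)         = sound-union (sound t₁ wf₁) (sound t₂ wf₂) apart
  sound (add v t)       (wf , v∉)                   = sound-add (sound t wf) v∉
  sound (merge S₁ S₂ t) (wf , S₁∈ , S₂∈ , S₁≢S₂) = sound-merge (sound t wf) S₁∈ S₂∈ S₁≢S₂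
  sound (arcs S₁ S₂ t)  (wf , S₁∈ , S₂∈)            = sound-arcs (sound t wf) S₁∈ S₂∈

module Members {n : ℕ} where

  mem⁺ : ∀ {S : Subset n} {x} → x ∈ S → x ∈ˡ members S
  mem⁺ {S} {x} x∈ = ∈-filter⁺ (_∈? S) (∈-allFin x) x∈

  mem⁻ : ∀ {S : Subset n} {x} → x ∈ˡ members S → x ∈ S
  mem⁻ {S} x∈ = proj₂ (∈-filter⁻ (_∈? S) {xs = allFin n} x∈)

  members-⁅⁆ : ∀ v → members ⁅ v ⁆ ≡ v ∷ []
  members-⁅⁆ v = unique-singleton (Unique.filter⁺ (_∈? ⁅ v ⁆) (Unique.allFin⁺ n)) (mem⁺ (x∈⁅x⁆ v))
                                   (x∈⁅y⁆⇒x≡y v ∘ mem⁻)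

  members-two : ∀ {S : Subset n} {x y} → x ∈ S → y ∈ S → x ≢ y →
                ∃[ a ] ∃[ b ] ∃[ rest ] (members S ≡ a ∷ b ∷ rest)
  members-two x∈ y∈ = two-entries (mem⁺ x∈) (mem⁺ y∈)

  first-member : ∀ {S : Subset n} {a rest} → members S ≡ a ∷ rest → a ∈ S
  first-member eq = mem⁻ (subst (_ ∈ˡ_) (sym eq) (here refl))

  data Size (S : Subset n) : Set where
    one     : ∀ {w} → members S ≡ w ∷ [] → Size S
    several : ∀ {a b rest} → members S ≡ a ∷ b ∷ rest → Size S

  size : ∀ {S : Subset n} → Nonempty S → Size S
  size {S} (x , x∈) with members S in eq | mem⁺ {S} x∈
  ... | _ ∷ []     | _ = one eq
  ... | _ ∷ _ ∷ _ | _ = several eq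

  module Extremes (f : Fin n → ℕ) where

    maxOver : Subset n → ℕ
    maxOver S = max 0 (map f (members S))

    -- the maximum serves as default value, so that minOver S ≤ maxOver S
    minOver : Subset n → ℕ
    minOver S = min (maxOver S) (map f (members S))

    private
      all-members : ∀ {P : ℕ → Set} {S} → (∀ {x} → x ∈ S → P (f x)) → All P (map f (members S))
      all-members P∈ = All-map⁺ (All.tabulate (P∈ ∘ mem⁻))

      image : ∀ {S x} → x ∈ S → f x ∈ˡ map f (members S)
      image = ∈-map⁺ f ∘ mem⁺

    ≤maxOver : ∀ {S x} → x ∈ S → f x ≤ maxOver S
    ≤maxOver {S} x∈ = All.lookup (xs≤max 0 (map f (members S))) (image x∈)

    maxOver< : ∀ {S c} → Nonempty S → (∀ {x} → x ∈ S → f x < c) → maxOver S < c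
    maxOver< (x , x∈) below = max<v⁺ (≤-<-trans z≤n (below x∈)) (all-members below)

    maxOver-mono : ∀ {S T} → S ⊆ T → maxOver S ≤ maxOver T
    maxOver-mono {S} S⊆T = max-mono-⊆ ≤-refl grow
      where
      grow : ∀ {y} → y ∈ˡ map f (members S) → y ∈ˡ map f (members _)
      grow y∈ with ∈-map⁻ f y∈
      ... | x , x∈ , refl = image (S⊆T (mem⁻ x∈))

    minOver≤ : ∀ {S x} → x ∈ S → minOver S ≤ f x
    minOver≤ {S} x∈ = All.lookup (min≤xs (maxOver S) (map f (members S))) (image x∈)

    <minOver : ∀ {S c} → Nonempty S → (∀ {x} → x ∈ S → c < f x) → c < minOver S
    <minOver (x , x∈) above = v<min⁺ (<-≤-trans (above x∈) (≤maxOver x∈)) (all-members above)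

    minOver-anti : ∀ {S T} → S ⊆ T → Nonempty S → minOver T ≤ minOver S
    minOver-anti S⊆T (x , x∈) =
      v≤min⁺ (≤-trans (minOver≤ (S⊆T x∈)) (≤maxOver x∈)) (all-members (minOver≤ ∘ S⊆T))

open Members

-- The rank is the height iterated n times; it is stable because a chain of
-- predecessors consists of distinct gates, hence has fewer than n wires.
module Rank {n : ℕ} (F : Circuit n) (t : SCD n) (scd : IsSCDOf F t)
            (acyclic : ∀ v → ¬ TransClosure (wire F) v v) where

  rootArc? : ∀ u v → Dec (rootArc t u v)
  rootArc? u v = map′ find (λ (p , p∈ , u∈ , v∈) → lose p∈ (u∈ , v∈))
                      (any? (λ p → (u ∈? proj₁ p) ×-dec (v ∈? proj₂ p)) (arcOps t))

  preds : Fin n → List (Fin n)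
  preds v = filter (λ u → rootArc? u v) (allFin n)

  pred⇒wire : ∀ {u v} → u ∈ˡ preds v → wire F u v
  pred⇒wire {u} {v} u∈ =
    Equivalence.from (proj₂ (proj₂ scd) u v) (proj₂ (∈-filter⁻ (λ u → rootArc? u v) {xs = allFin n} u∈))

  wire⇒pred : ∀ {u v} → wire F u v → u ∈ˡ preds v
  wire⇒pred {u} {v} w = ∈-filter⁺ (λ u → rootArc? u v) (∈-allFin u) (Equivalence.to (proj₂ (proj₂ scd) u v) w)

  -- height k v: length of the longest path of at most k wires ending in v
  height : ℕ → Fin n → ℕ
  height zero    v = 0
  height (suc k) v = max 0 (map suc (map (height k) (preds v)))

  height-wire : ∀ k {u v} → wire F u v → suc (height k u) ≤ height (suc k) v
  height-wire k {u} {v} w =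
    All.lookup (xs≤max 0 (map suc (map (height k) (preds v)))) (∈-map⁺ suc (∈-map⁺ (height k) (wire⇒pred w)))

  module Height = Iteration _≟ⁿ_ preds (λ _ hs → max 0 (map suc hs)) height (λ _ _ → refl)

  height-stable : ∀ v → height n v ≡ height (suc n) v
  height-stable v = Height.stable n v no-long-chain
    where
    Reaches : Rel (Fin n) 0ℓ
    Reaches x y = TransClosure (wire F) y x
    no-long-chain : ∀ {xs} → Linked Height.Next (v ∷ xs) → length xs ≢ n
    no-long-chain {xs} chain len = 1+n≰n (begin
      suc n                  ≡⟨ cong suc (sym len) ⟩
      length (v ∷ xs)        ≤⟨ chain-length≤ {R = Reaches} (λ x←y y←z → y←z ++⁺ x←y) (λ {x} → acyclic x)
                                  (Linked.map ([_] ∘ pred⇒wire) chain) (λ {z} _ → ∈-allFin z) ⟩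
      length (allFin n)      ≡⟨ length-tabulate (λ x → x) ⟩
      n                      ∎)
      where open ≤-Reasoning

  rank : Fin n → ℕ
  rank = height n

  rank-wire : ∀ {u v} → wire F u v → rank u < rank v
  rank-wire {u} {v} w = ≤-trans (height-wire n w) (≤-reflexive (sym (height-stable v)))

  arc-wire : ∀ {S₁ S₂ u v} → (S₁ , S₂) ∈ˡ arcOps t → u ∈ S₁ → v ∈ S₂ → wire F u v
  arc-wire {S₁} {S₂} {u} {v} arc u∈ v∈ = Equivalence.from (proj₂ (proj₂ scd) u v) ((S₁ , S₂) , arc , u∈ , v∈)

  rank-arc : ∀ {S₁ S₂ u v} → (S₁ , S₂) ∈ˡ arcOps t → u ∈ S₁ → v ∈ S₂ → rank u < rank v
  rank-arc arc u∈ v∈ = rank-wire (arc-wire arc u∈ v∈)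

module Gates {n : ℕ} (F : Circuit n) (t : SCD n) (choice : Subset n → Subset n → Bool) where
  open Construction F t choice

  singleton-oandG : ∀ {S w} → members S ≡ w ∷ [] → oandG S ≡ orig w
  singleton-oandG eq rewrite eq = refl

  singleton-oorG : ∀ {S w} → members S ≡ w ∷ [] → oorG S ≡ orig w
  singleton-oorG eq rewrite eq = refl

  several-oandG : ∀ {S a b rest} → members S ≡ a ∷ b ∷ rest → oandG S ≡ oand S
  several-oandG eq rewrite eq = refl

  several-oorG : ∀ {S a b rest} → members S ≡ a ∷ b ∷ rest → oorG S ≡ oor S
  several-oorG eq rewrite eq = refl

  stype-members : ∀ {S a rest} → members S ≡ a ∷ rest → stype S ≡ ktype (kind F a)
  stype-members eq rewrite eq = refl

  several-inOut : ∀ {S a b rest} → members S ≡ a ∷ b ∷ rest → inOut S ≡ inA S ⊎ inOut S ≡ inB S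
  several-inOut {S} eq rewrite eq with stype S
  ... | unaryT = inj₂ refl
  ... | andT   = inj₁ refl
  ... | orT    = inj₁ refl

  unary-inOut : ∀ {S a b rest} → members S ≡ a ∷ b ∷ rest → stype S ≡ unaryT → inOut S ≡ inB S
  unary-inOut {S} {a} eq unary = go (trans (sym (stype-members eq)) unary)
    where
    -- inOut inspects members S twice: directly, and through stype S
    go : ktype (kind F a) ≡ unaryT → inOut S ≡ inB S
    go unary-a rewrite eq | eq | unary-a = refl

  op-inA-unary : ∀ {S} → stype S ≡ unaryT → op (inA S) ≡ opNot
  op-inA-unary {S} unary with stype S | unary
  ... | _ | refl = refl

  op-orig-not : ∀ {v} → kind F v ≡ notK → op (orig v) ≡ opNot
  op-orig-not {v} not-gate with kind F v | not-gate
  ... | _ | refl = refl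

  source-choice : ∀ S₁ S₂ → source S₁ S₂ ≡ oandG S₁ ⊎ source S₁ S₂ ≡ oorG S₁
  source-choice S₁ S₂ with stype S₂
  ... | andT   = inj₁ refl
  ... | orT    = inj₂ refl
  ... | unaryT with choice S₁ S₂
  ...   | true  = inj₁ refl
  ...   | false = inj₂ refl

module Selection {n : ℕ} (ps : List (Subset n × Subset n)) where

  firsts⁻ : ∀ {S T} → S ∈ˡ map proj₁ (filterᵇ (λ p → proj₂ p ==ˢ T) ps) → (S , T) ∈ˡ ps
  firsts⁻ {T = T} S∈ with ∈-map⁻ proj₁ S∈
  ... | p , p∈ , refl with ∈-filterᵇ⁻ (λ p → proj₂ p ==ˢ T) {xs = ps} p∈
  ...   | p∈ps , same = subst (λ T′ → (proj₁ p , T′) ∈ˡ ps) (toWitness same) p∈ps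

  firsts⁺ : ∀ {S T} → (S , T) ∈ˡ ps → S ∈ˡ map proj₁ (filterᵇ (λ p → proj₂ p ==ˢ T) ps)
  firsts⁺ {T = T} p∈ = ∈-map⁺ proj₁ (∈-filterᵇ⁺ (λ p → proj₂ p ==ˢ T) p∈ (fromWitness refl))

  seconds⁻ : ∀ {S T} → T ∈ˡ map proj₂ (filterᵇ (λ p → proj₁ p ==ˢ S) ps) → (S , T) ∈ˡ ps
  seconds⁻ {S = S} T∈ with ∈-map⁻ proj₂ T∈
  ... | p , p∈ , refl with ∈-filterᵇ⁻ (λ p → proj₁ p ==ˢ S) {xs = ps} p∈
  ...   | p∈ps , same = subst (λ S′ → (S′ , proj₂ p) ∈ˡ ps) (toWitness same) p∈ps

  seconds⁺ : ∀ {S T} → (S , T) ∈ˡ ps → T ∈ˡ map proj₂ (filterᵇ (λ p → proj₁ p ==ˢ S) ps)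
  seconds⁺ {S = S} p∈ = ∈-map⁺ proj₂ (∈-filterᵇ⁺ (λ p → proj₁ p ==ˢ S) p∈ (fromWitness refl))

module Structure {n : ℕ} (F : Circuit n) (t : SCD n) (choice : Subset n → Subset n → Bool) (wf : WF t) where
  open Construction F t choice
  open Gates F t choice
  open Decomposition
  open Sound (sound t wf)

  merge-ok : ∀ {S₁ S₂} → (S₁ , S₂) ∈ˡ merges t → MergeOK t (S₁ , S₂)
  merge-ok = All.lookup merges-ok

  arc-ok : ∀ {S₁ S₂} → (S₁ , S₂) ∈ˡ arcOps t → ArcOK t (S₁ , S₂)
  arc-ok = All.lookup arcs-ok

  -- the union of two disjoint nonempty labels has at least two members
  several-members : ∀ {S} → IsNonSingleton t S → ∃[ a ] ∃[ b ] ∃[ rest ] (members S ≡ a ∷ b ∷ rest)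
  several-members ((S₁ , S₂) , p∈ , refl) with merge-ok p∈
  ... | ((x , x∈) , _) , ((y , y∈) , _) , apart =
    members-two (x∈p∪q⁺ (inj₁ x∈)) (x∈p∪q⁺ (inj₂ y∈)) (λ { refl → apart x∈ y∈ })

  data ChildOf : Subset n → Subset n → Set where
    first  : ∀ {S₁ S₂} → (S₁ , S₂) ∈ˡ merges t → ChildOf S₁ (S₁ ∪ S₂)
    second : ∀ {S₁ S₂} → (S₁ , S₂) ∈ˡ merges t → ChildOf S₂ (S₁ ∪ S₂)

  private
    pairsOf : Subset n × Subset n → List (Subset n × Subset n)
    pairsOf p = (proj₁ p , proj₁ p ∪ proj₂ p) ∷ (proj₂ p , proj₁ p ∪ proj₂ p) ∷ []

  childPair⁻ : ∀ {C P} → (C , P) ∈ˡ childPairs → ChildOf C P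
  childPair⁻ C∈ with find (∈-concatMap⁻ pairsOf {xs = merges t} C∈)
  ... | _ , p∈ , here refl         = first p∈
  ... | _ , p∈ , there (here refl) = second p∈

  childPair⁺ : ∀ {C P} → ChildOf C P → (C , P) ∈ˡ childPairs
  childPair⁺ (first p∈)  = ∈-concatMap⁺ pairsOf (Any.map (λ { refl → here refl }) p∈)
  childPair⁺ (second p∈) = ∈-concatMap⁺ pairsOf (Any.map (λ { refl → there (here refl) }) p∈)

  child-operand : ∀ {C P} → ChildOf C P → Operand t C
  child-operand (first p∈)  = proj₁ (merge-ok p∈)
  child-operand (second p∈) = proj₁ (proj₂ (merge-ok p∈))

  parent-union : ∀ {C P} → ChildOf C P → IsNonSingleton t P
  parent-union (first p∈)  = _ , p∈ , refl
  parent-union (second p∈) = _ , p∈ , refl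

  child⊂parent : ∀ {C P} → ChildOf C P → C ⊂ P
  child⊂parent (first p∈) with merge-ok p∈
  ... | _ , ((y , y∈) , _) , apart = (λ x∈ → x∈p∪q⁺ (inj₁ x∈)) , y , x∈p∪q⁺ (inj₂ y∈) , (λ y∈₁ → apart y∈₁ y∈)
  child⊂parent (second p∈) with merge-ok p∈
  ... | ((x , x∈) , _) , _ , apart = (λ y∈ → x∈p∪q⁺ (inj₂ y∈)) , x , x∈p∪q⁺ (inj₁ x∈) , apart x∈

  child-containing : ∀ {P g} → IsNonSingleton t P → g ∈ P → ∃[ C ] (ChildOf C P × g ∈ C)
  child-containing ((S₁ , S₂) , p∈ , refl) g∈ with x∈p∪q⁻ S₁ S₂ g∈
  ... | inj₁ g∈₁ = S₁ , first p∈ , g∈₁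
  ... | inj₂ g∈₂ = S₂ , second p∈ , g∈₂

  children⁻ : ∀ {C P} → C ∈ˡ children P → ChildOf C P
  children⁻ = childPair⁻ ∘ Selection.firsts⁻ childPairs

  parents⁻ : ∀ {S Q} → Q ∈ˡ parents S → ChildOf S Q
  parents⁻ = childPair⁻ ∘ Selection.seconds⁻ childPairs

  parents⁺ : ∀ {S Q} → ChildOf S Q → Q ∈ˡ parents S
  parents⁺ = Selection.seconds⁺ childPairs ∘ childPair⁺

  NoInputGate : Subset n → Set
  NoInputGate S = hasInputGate S ≡ false

  private
    isInput⇒input : ∀ {k} → T (isInput k) → k ≡ inputK
    isInput⇒input {inputK} _ = refl

  no-input-gate : ∀ {S} → (∀ {v} → v ∈ S → kind F v ≢ inputK) → NoInputGate S
  no-input-gate {S} none with hasInputGate S in has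
  ... | false = refl
  ... | true with find (any⁻ (λ v → isInput (kind F v)) (members S) (subst T (sym has) tt))
  ...   | v , v∈ , is-input = ⊥-elim (none (mem⁻ v∈) (isInput⇒input is-input))

  no-input-⊆ : ∀ {C P} → C ⊆ P → NoInputGate P → NoInputGate C
  no-input-⊆ {C} {P} C⊆P none = no-input-gate λ {v} v∈ input →
    subst T none (any⁺ (λ v → isInput (kind F v)) (lose (mem⁺ (C⊆P v∈)) (subst (T ∘ isInput) (sym input) tt)))

  data InInput (S : Subset n) : Gate* n → Set where
    from-parent : ∀ {Q} → ChildOf S Q → NoInputGate Q → InInput S (inOut Q)
    from-arc    : ∀ {S₁} → (S₁ , S) ∈ˡ arcOps t → InInput S (source S₁ S)

  inInputs⁻ : ∀ {S z} → z ∈ˡ inInputs S → InInput S z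
  inInputs⁻ {S} z∈ with ∈-++⁻ (map inOut (filterᵇ (λ P → not (hasInputGate P)) (parents S))) z∈
  ... | inj₁ z∈parents with ∈-map⁻ inOut z∈parents
  ...   | Q , Q∈ , refl with ∈-filterᵇ⁻ (λ P → not (hasInputGate P)) Q∈
  ...     | Q∈parents , no-input = from-parent (parents⁻ Q∈parents) (Equivalence.to T-not-≡ no-input)
  inInputs⁻ {S} z∈ | inj₂ z∈arcs with ∈-map⁻ (λ S₁ → source S₁ S) z∈arcs
  ...   | S₁ , S₁∈ , refl = from-arc (Selection.firsts⁻ (arcOps t) S₁∈)

  parent∈inInputs : ∀ {S Q} → ChildOf S Q → NoInputGate Q → inOut Q ∈ˡ inInputs S
  parent∈inInputs child no-input =
    ∈-++⁺ˡ (∈-map⁺ inOut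
      (∈-filterᵇ⁺ (λ P → not (hasInputGate P)) (parents⁺ child) (Equivalence.from T-not-≡ no-input)))

  arc∈inInputs : ∀ {S₁ S} → (S₁ , S) ∈ˡ arcOps t → source S₁ S ∈ˡ inInputs S
  arc∈inInputs {S₁} {S} arc =
    ∈-++⁺ʳ (map inOut (filterᵇ (λ P → not (hasInputGate P)) (parents S)))
           (∈-map⁺ (λ S₁ → source S₁ S) (Selection.firsts⁺ (arcOps t) arc))

  Built : Gate* n → Set
  Built (orig _) = ⊤
  Built (oand S) = IsNonSingleton t S
  Built (oor S)  = IsNonSingleton t S
  Built (inA S)  = IsNonSingleton t S
  Built (inB S)  = IsNonSingleton t S

  labelGates : Subset n → List (Gate* n)
  labelGates S = oand S ∷ oor S ∷ inA S ∷ inB S ∷ []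

  builtGates : List (Gate* n)
  builtGates = map orig (allFin n) ++ concatMap (λ p → labelGates (proj₁ p ∪ proj₂ p)) (merges t)

  length-builtGates : length builtGates ≡ bound
  length-builtGates = begin
    length builtGates                                 ≡⟨ length-++ (map orig (allFin n)) ⟩
    length (map orig (allFin n)) + length (gatesOf (merges t))
                                                      ≡⟨ cong₂ _+_ originals (four-each (merges t)) ⟩
    n + 4 * length (merges t)                         ∎
    where
    open ≡-Reasoning
    gatesOf : List (Subset n × Subset n) → List (Gate* n)
    gatesOf = concatMap (λ p → labelGates (proj₁ p ∪ proj₂ p))
    originals : length (map orig (allFin n)) ≡ n
    originals = trans (length-map orig (allFin n)) (length-tabulate {n = n} (λ x → x))
    four-each : ∀ ps → length (gatesOf ps) ≡ 4 * length ps
    four-each []       = refl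
    four-each (p ∷ ps) = trans (cong (4 +_) (four-each ps)) (sym (*-suc 4 (length ps)))

  private
    union-gate : ∀ {p x} → p ∈ˡ merges t → x ∈ˡ labelGates (proj₁ p ∪ proj₂ p) → x ∈ˡ builtGates
    union-gate p∈ x∈ = ∈-++⁺ʳ (map orig (allFin n))
      (∈-concatMap⁺ (λ p → labelGates (proj₁ p ∪ proj₂ p)) (Any.map (λ { refl → x∈ }) p∈))

  built∈builtGates : ∀ {x} → Built x → x ∈ˡ builtGates
  built∈builtGates {orig v} _                 = ∈-++⁺ˡ (∈-map⁺ orig (∈-allFin v))
  built∈builtGates {oand S} (p , p∈ , refl) = union-gate p∈ (here refl)
  built∈builtGates {oor S}  (p , p∈ , refl) = union-gate p∈ (there (here refl))
  built∈builtGates {inA S}  (p , p∈ , refl) = union-gate p∈ (there (there (here refl)))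
  built∈builtGates {inB S}  (p , p∈ , refl) = union-gate p∈ (there (there (there (here refl))))

  oandG-built : ∀ {S} → Label t S → Built (oandG S)
  oandG-built (inj₁ (v , refl)) = subst Built (sym (singleton-oandG (members-⁅⁆ v))) tt
  oandG-built (inj₂ merged) with several-members merged
  ... | _ , _ , _ , eq = subst Built (sym (several-oandG eq)) merged

  oorG-built : ∀ {S} → Label t S → Built (oorG S)
  oorG-built (inj₁ (v , refl)) = subst Built (sym (singleton-oorG (members-⁅⁆ v))) tt
  oorG-built (inj₂ merged) with several-members merged
  ... | _ , _ , _ , eq = subst Built (sym (several-oorG eq)) merged

  source-built : ∀ {S₁} S₂ → Label t S₁ → Built (source S₁ S₂)
  source-built {S₁} S₂ label with source-choice S₁ S₂
  ... | inj₁ eq = subst Built (sym eq) (oandG-built label)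
  ... | inj₂ eq = subst Built (sym eq) (oorG-built label)

  inOut-built : ∀ {S} → IsNonSingleton t S → Built (inOut S)
  inOut-built merged with several-members merged
  ... | _ , _ , _ , eq with several-inOut eq
  ...   | inj₁ isA = subst Built (sym isA) merged
  ...   | inj₂ isB = subst Built (sym isB) merged

  inInputs-built : ∀ {S z} → z ∈ˡ inInputs S → Built z
  inInputs-built {S} z∈ with inInputs⁻ z∈
  ... | from-parent child _ = inOut-built (parent-union child)
  ... | from-arc arc        = source-built S (proj₂ (proj₁ (arc-ok arc)))

  inputs-built : ∀ {x z} → Built x → z ∈ˡ inputs x → Built z
  inputs-built {orig v} _     z∈          = inInputs-built z∈
  inputs-built {inA S}  _     z∈          = inInputs-built z∈
  inputs-built {inB S}  merged (here refl) = merged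
  inputs-built {oand S} _     z∈ with ∈-map⁻ oandG z∈
  ... | C , C∈ , refl = oandG-built (proj₂ (child-operand (children⁻ C∈)))
  inputs-built {oor S}  _     z∈ with ∈-map⁻ oorG z∈
  ... | C , C∈ , refl = oorG-built (proj₂ (child-operand (children⁻ C∈)))

-- F* is acyclic on its built gates: a potential built from the ranks of F strictly
-- decreases (lexicographically) from every built gate to each of its inputs.  Hence a
-- path of F* starting at a built gate consists of distinct built gates.
module Acyclicity {n : ℕ} (F : Circuit n) (t : SCD n) (choice : Subset n → Subset n → Bool)
                  (cF : IsCircuit F) (scd : IsSCDOf F t) where
  open Construction F t choice
  open Gates F t choice
  open Structure F t choice (proj₁ scd)
  open Rank F t scd (IsCircuit.acyclic cF)
  open Extremes rank

  Potential : Set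
  Potential = ℕ × ℕ × ℕ

  _≺_ : Rel Potential 0ℓ
  _≺_ = ×-Lex _≡_ _<_ (×-Lex _≡_ _<_ _<_)

  ≺-trans : Transitive _≺_
  ≺-trans = ×-transitive {_<₂_ = ×-Lex _≡_ _<_ _<_} isEquivalence (resp₂ _<_) <-trans
                         (×-transitive {_<₂_ = _<_} isEquivalence (resp₂ _<_) <-trans <-trans)

  ≺-irrefl : ∀ {p} → ¬ (p ≺ p)
  ≺-irrefl (inj₁ a<a)                 = <-irrefl refl a<a
  ≺-irrefl (inj₂ (_ , inj₁ b<b))       = <-irrefl refl b<b
  ≺-irrefl (inj₂ (_ , inj₂ (_ , c<c))) = <-irrefl refl c<c

  ≺-phase : ∀ {a b c a′ b′ c′} → a ≤ a′ → b < b′ → (a , b , c) ≺ (a′ , b′ , c′)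
  ≺-phase a≤a′ b<b′ with m≤n⇒m<n∨m≡n a≤a′
  ... | inj₁ a<a′ = inj₁ a<a′
  ... | inj₂ a≡a′ = inj₂ (a≡a′ , inj₁ b<b′)

  ≺-size : ∀ {a b c a′ c′} → a ≤ a′ → c < c′ → (a , b , c) ≺ (a′ , b , c′)
  ≺-size a≤a′ c<c′ with m≤n⇒m<n∨m≡n a≤a′
  ... | inj₁ a<a′ = inj₁ a<a′
  ... | inj₂ a≡a′ = inj₂ (a≡a′ , inj₂ (refl , c<c′))

  -- (level, phase, size): the level bounds the ranks of the gates a gate depends on;
  -- within a level, in-gates come before original gates, which come before output gates.
  π : Gate* n → Potential
  π (orig v) = rank v , 1 , 0
  π (oand S) = maxOver S , 2 , ∣ S ∣
  π (oor S)  = maxOver S , 2 , ∣ S ∣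
  π (inA S)  = minOver S , 0 , 2 * ∣ ∁ S ∣
  π (inB S)  = minOver S , 0 , suc (2 * ∣ ∁ S ∣)

  level : Gate* n → ℕ
  level = proj₁ ∘ π

  π-oorG : ∀ {S} → Nonempty S → π (oorG S) ≡ π (oandG S)
  π-oorG ne with size ne
  ... | one eq     = cong π (trans (singleton-oorG eq) (sym (singleton-oandG eq)))
  ... | several eq = trans (cong π (several-oorG eq)) (cong π (sym (several-oandG eq)))

  level-oandG : ∀ {S} → Nonempty S → level (oandG S) ≤ maxOver S
  level-oandG ne with size ne
  ... | one eq     = subst (_≤ maxOver _) (sym (cong level (singleton-oandG eq))) (≤maxOver (first-member eq))
  ... | several eq = subst (_≤ maxOver _) (sym (cong level (several-oandG eq))) ≤-refl

  level-source : ∀ {S₁} S₂ → Nonempty S₁ → level (source S₁ S₂) ≤ maxOver S₁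
  level-source {S₁} S₂ ne with source-choice S₁ S₂
  ... | inj₁ eq = subst (_≤ maxOver S₁) (sym (cong level eq)) (level-oandG ne)
  ... | inj₂ eq = subst (_≤ maxOver S₁) (sym (trans (cong level eq) (cong proj₁ (π-oorG ne)))) (level-oandG ne)

  private
    double< : ∀ {a b} → a < b → suc (2 * a) < 2 * b
    double< {a} {b} a<b = subst (_≤ 2 * b) (*-suc 2 a) (*-monoʳ-≤ 2 a<b)

  output-below : ∀ {C S} → ChildOf C S → π (oandG C) ≺ (maxOver S , 2 , ∣ S ∣)
  output-below child with size (proj₁ (child-operand child))
  ... | one eq = subst (_≺ _) (sym (cong π (singleton-oandG eq)))
                   (≺-phase (≤maxOver (proj₁ (child⊂parent child) (first-member eq))) (s≤s (s≤s z≤n)))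
  ... | several eq = subst (_≺ _) (sym (cong π (several-oandG eq)))
                       (≺-size (maxOver-mono (proj₁ (child⊂parent child))) (p⊂q⇒∣p∣<∣q∣ (child⊂parent child)))

  -- the output of the in-gate of a union is in(Q) itself or the NOT gate behind it
  inOut-below : ∀ {Q p} → IsNonSingleton t Q → π (inB Q) ≺ p → π (inOut Q) ≺ p
  inOut-below merged below with several-members merged
  ... | _ , _ , _ , eq with several-inOut eq
  ...   | inj₁ isA = subst (_≺ _) (sym (cong π isA)) (≺-trans (≺-size ≤-refl (n<1+n _)) below)
  ...   | inj₂ isB = subst (_≺ _) (sym (cong π isB)) below

  -- arcs lead to gates of higher rank, in-gates feed the in-gates of the children, and
  -- the outputs of the children feed the outputs of their parent
  potential-decreases : ∀ {x z} → Built x → z ∈ˡ inputs x → π z ≺ π x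
  potential-decreases {orig v} _ z∈ with inInputs⁻ z∈
  ... | from-parent child _ =
        inOut-below (parent-union child) (≺-phase (minOver≤ (proj₁ (child⊂parent child) (x∈⁅x⁆ v))) (s≤s z≤n))
  ... | from-arc arc =
        let ne₁ = proj₁ (proj₁ (arc-ok arc)) in
        inj₁ (≤-<-trans (level-source _ ne₁) (maxOver< ne₁ (λ u∈ → rank-arc arc u∈ (x∈⁅x⁆ v))))
  potential-decreases {inA S} _ z∈ with inInputs⁻ z∈
  ... | from-parent child _ =
        inOut-below (parent-union child)
          (≺-size (minOver-anti (proj₁ (child⊂parent child)) (proj₁ (child-operand child)))
                  (double< (p⊂q⇒∣p∣<∣q∣ (p⊂q⇒∁p⊃∁q (child⊂parent child)))))
  ... | from-arc arc =
        let (ne₁ , _) , (ne₂ , _) = arc-ok arc in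
        inj₁ (≤-<-trans (level-source S ne₁) (<minOver ne₂ (λ v∈ → maxOver< ne₁ (λ u∈ → rank-arc arc u∈ v∈))))
  potential-decreases {inB S} _ (here refl) = ≺-size ≤-refl (n<1+n _)
  potential-decreases {oand S} _ z∈ with ∈-map⁻ oandG z∈
  ... | C , C∈ , refl = output-below (children⁻ C∈)
  potential-decreases {oor S} _ z∈ with ∈-map⁻ oorG z∈
  ... | C , C∈ , refl =
        subst (_≺ _) (sym (π-oorG (proj₁ (child-operand (children⁻ C∈))))) (output-below (children⁻ C∈))

  -- z is an input of x in F* (before removal of input-less gates)
  In : Rel (Gate* n) 0ℓ
  In x z = z ∈ˡ inputs x

  path-length≤ : ∀ {x xs} → Built x → Linked In (x ∷ xs) → length (x ∷ xs) ≤ bound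
  path-length≤ built path =
    ≤-trans (chain-length≤ (λ y<x z<y → ≺-trans z<y y<x) ≺-irrefl (descending built path)
                           (built∈builtGates ∘ All.lookup (all-built built path)))
            (≤-reflexive length-builtGates)
    where
    Descends : Rel (Gate* n) 0ℓ
    Descends x y = π y ≺ π x
    descending : ∀ {x xs} → Built x → Linked In (x ∷ xs) → Linked Descends (x ∷ xs)
    descending _     [-]          = [-]
    descending built (z∈ ∷ path) = potential-decreases built z∈ ∷ descending (inputs-built built z∈) path
    all-built : ∀ {x xs} → Built x → Linked In (x ∷ xs) → All Built (x ∷ xs)
    all-built built [-]          = built ∷ []
    all-built built (z∈ ∷ path) = built ∷ all-built (inputs-built built z∈) path

-- F* evaluated with fuel `bound` satisfies the gate equations at every built gate,
-- since no path below a built gate is long enough to exhaust the fuel.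
-- (A circuit with a gate has n = suc m, so bound = suc fuel.)
module Equations {m : ℕ} (F : Circuit (suc m)) (t : SCD (suc m)) (choice : Subset (suc m) → Subset (suc m) → Bool)
                 (cF : IsCircuit F) (scd : IsSCDOf F t) where
  open Construction F t choice
  open Structure F t choice (proj₁ scd)
  open Acyclicity F t choice cF scd

  fuel : ℕ
  fuel = pred bound

  short-paths : ∀ {x z zs} → Built x → z ∈ˡ inputs x → Linked In (z ∷ zs) → length zs ≢ fuel
  short-paths built z∈ path len = 1+n≰n (subst (λ k → suc (suc k) ≤ bound) len (path-length≤ built (z∈ ∷ path)))

  -- the removal of input-less in-gates and the evaluation are iterations along inputs
  presence-step : Gate* (suc m) → List Bool → Bool
  presence-step (inA _) = or
  presence-step (inB _) = or
  presence-step _       = λ _ → true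

  presence-suc : ∀ k x → present (suc k) x ≡ presence-step x (map (present k) (inputs x))
  presence-suc k (orig _) = refl
  presence-suc k (oand _) = refl
  presence-suc k (oor _)  = refl
  presence-suc k (inA _)  = refl
  presence-suc k (inB _)  = refl

  module Presence = Iteration _≟ᵇ_ inputs presence-step present presence-suc
  module Evaluation (ρ : Fin (suc m) → Bool) = Iteration _≟ᵇ_ inputs* (apply ρ ∘ op) (eval ρ) (λ _ _ → refl)

  present-stable : ∀ {x z} → Built x → z ∈ˡ inputs x → present fuel z ≡ alive z
  present-stable built z∈ = Presence.stable fuel _ (short-paths built z∈)

  eval-stable : ∀ ρ {x z} → Built x → z ∈ˡ inputs* x → eval ρ fuel z ≡ f z ρ
  eval-stable ρ {x} built z∈ =
    Evaluation.stable ρ fuel _ (short-paths built (live⇒input {x} z∈) ∘ Linked.map (λ {y} → live⇒input {y}))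
    where
    live⇒input : ∀ {y z} → z ∈ˡ inputs* y → z ∈ˡ inputs y
    live⇒input {y} = proj₁ ∘ ∈-filterᵇ⁻ alive {xs = inputs y}

  alive-orig : ∀ v → T (alive (orig v))
  alive-orig v = tt

  alive-inA : ∀ {S} → Built (inA S) → alive (inA S) ≡ any alive (inInputs S)
  alive-inA {S} built = cong or (map-cong-local (All.tabulate (present-stable {inA S} built)))

  alive-inB : ∀ {S} → Built (inB S) → alive (inB S) ≡ alive (inA S)
  alive-inB {S} built = trans (cong (_∨ false) (present-stable {inB S} built (here refl))) (∨-identityʳ _)

  f-equation : ∀ ρ {x} → Built x → f x ρ ≡ apply ρ (op x) (map (λ z → f z ρ) (inputs* x))
  f-equation ρ {x} built = cong (apply ρ (op x)) (map-cong-local (All.tabulate (eval-stable ρ {x} built)))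

  negation : ∀ ρ {x c} → Built x → op x ≡ opNot → (∀ {z} → z ∈ˡ inputs* x → f z ρ ≡ c) →
             ∃[ z ] z ∈ˡ inputs* x → f x ρ ≡ not c
  negation ρ {x} {c} built is-not all-c live = begin
    f x ρ                                          ≡⟨ f-equation ρ built ⟩
    apply ρ (op x) (map (λ z → f z ρ) (inputs* x)) ≡⟨ cong (λ o → apply ρ o (map (λ z → f z ρ) (inputs* x))) is-not ⟩
    not (and (map (λ z → f z ρ) (inputs* x)))      ≡⟨ cong not (and-constant (λ z → f z ρ) all-c live) ⟩
    not c                                          ∎
    where open ≡-Reasoning

  live-input : ∀ {S} → Built (inA S) → T (alive (inA S)) → ∃[ z ] z ∈ˡ inputs* (inA S)
  live-input {S} built live with find (any⁻ alive (inInputs S) (subst T (alive-inA built) live))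
  ... | z , z∈ , live-z = z , ∈-filterᵇ⁺ alive z∈ live-z

  alive-from-input : ∀ {S z} → Built (inA S) → z ∈ˡ inInputs S → T (alive z) → T (alive (inA S))
  alive-from-input built z∈ live = subst T (sym (alive-inA built)) (any⁺ alive (lose z∈ live))

module NotGate {m : ℕ} (F : Circuit (suc m)) (t : SCD (suc m)) (choice : Subset (suc m) → Subset (suc m) → Bool)
               (cF : IsCircuit F) (scd : IsSCDOf F t) (typed : TypeRespecting F t)
               (g g′ : Fin (suc m)) (not-gate : kind F g ≡ notK) (g′→g : wire F g′ g) (ρ : Fin (suc m) → Bool) where
  open Construction F t choice
  open Gates F t choice
  open Structure F t choice (proj₁ scd)
  open Rank F t scd (IsCircuit.acyclic cF) using (arc-wire)
  open Equations F t choice cF scd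

  value : Gate* (suc m) → Bool
  value x = f x ρ

  only-input : ∀ {w} → wire F w g → w ≡ g′
  only-input w→g with IsCircuit.notOneIn cF g not-gate
  ... | _ , _ , unique = trans (unique _ w→g) (sym (unique _ g′→g))

  arc-from-g′ : ∀ {S₁ S} → (S₁ , S) ∈ˡ arcOps t → g ∈ S → S₁ ≡ ⁅ g′ ⁆
  arc-from-g′ {S₁} arc g∈ = ⊆-antisym (λ u∈ → subst (_∈ ⁅ g′ ⁆) (sym (is-g′ u∈)) (x∈⁅x⁆ g′)) g′∈
    where
    is-g′ : ∀ {u} → u ∈ S₁ → u ≡ g′
    is-g′ u∈ = only-input (arc-wire arc u∈ g∈)
    g′∈ : ⁅ g′ ⁆ ⊆ S₁
    g′∈ x∈ with proj₁ (proj₁ (arc-ok arc))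
    ... | u , u∈ = subst (_∈ S₁) (trans (is-g′ u∈) (sym (x∈⁅y⁆⇒x≡y g′ x∈))) u∈

  source-g′ : ∀ S → source ⁅ g′ ⁆ S ≡ orig g′
  source-g′ S with source-choice ⁅ g′ ⁆ S
  ... | inj₁ eq = trans eq (singleton-oandG (members-⁅⁆ g′))
  ... | inj₂ eq = trans eq (singleton-oorG (members-⁅⁆ g′))

  -- input gates have no incoming wires, so targets of arcs contain none
  arc-target-no-input : ∀ {S₁ S} → (S₁ , S) ∈ˡ arcOps t → NoInputGate S
  arc-target-no-input arc with proj₁ (proj₁ (arc-ok arc))
  ... | u , u∈ = no-input-gate (λ v∈ → IsCircuit.inputNoIn cF u _ (arc-wire arc u∈ v∈))

  unary-above : ∀ {S} → IsNonSingleton t S → g ∈ S → stype S ≡ unaryT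
  unary-above {S} merged g∈ with several-members merged
  ... | a , _ , _ , eq = trans (stype-members {S} eq)
          (trans (typed S merged a g (first-member eq) g∈) (cong ktype not-gate))

  inOut-above : ∀ {P} → IsNonSingleton t P → g ∈ P → inOut P ≡ inB P
  inOut-above merged g∈ with several-members merged
  ... | _ , _ , _ , eq = unary-inOut eq (unary-above merged g∈)

  live-inputs-above : ∀ {S} → g ∈ S →
                      (∀ {Q} → ChildOf S Q → T (alive (inA Q)) → value (inA Q) ≡ not (value (orig g′))) →
                      ∀ {z} → z ∈ˡ filterᵇ alive (inInputs S) → value z ≡ value (orig g′)
  live-inputs-above {S} g∈ parents-ok z∈ with ∈-filterᵇ⁻ alive z∈
  ... | z∈′ , live with inInputs⁻ z∈′
  ... | from-arc arc = cong value (trans (cong (λ X → source X S) (arc-from-g′ arc g∈)) (source-g′ S))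
  ... | from-parent {Q} child _ = begin
          value (inOut Q)             ≡⟨ cong value (inOut-above merged g∈Q) ⟩
          value (inB Q)               ≡⟨ negation ρ {inB Q} merged refl only-inA
                                           (inA Q , ∈-filterᵇ⁺ alive (here refl) live-inA) ⟩
          not (not (value (orig g′))) ≡⟨ not-involutive _ ⟩
          value (orig g′)             ∎
    where
    open ≡-Reasoning
    merged = parent-union child
    g∈Q = proj₁ (child⊂parent child) g∈
    live-inA : T (alive (inA Q))
    live-inA = subst T (alive-inB {Q} merged) (subst (T ∘ alive) (inOut-above merged g∈Q) live)
    only-inA : ∀ {y} → y ∈ˡ inputs* (inB Q) → value y ≡ not (value (orig g′))
    only-inA y∈ with ∈-filterᵇ⁻ alive {xs = inA Q ∷ []} y∈
    ... | here refl , _ = parents-ok child live-inA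

  inA-above : ∀ P → Acc _⊃_ P → IsNonSingleton t P → g ∈ P → T (alive (inA P)) → value (inA P) ≡ not (value (orig g′))
  inA-above P (acc larger) merged g∈ live =
    negation ρ {inA P} merged (op-inA-unary {P} (unary-above merged g∈))
             (live-inputs-above g∈ parents-ok) (live-input merged live)
    where
    parents-ok : ∀ {Q} → ChildOf P Q → T (alive (inA Q)) → value (inA Q) ≡ not (value (orig g′))
    parents-ok child = inA-above _ (larger (child⊂parent child)) (parent-union child) (proj₁ (child⊂parent child) g∈)

  live-output : ∀ {P} → IsNonSingleton t P → g ∈ P → T (alive (inA P)) → T (alive (inOut P))
  live-output {P} merged g∈ live =
    subst (T ∘ alive) (sym (inOut-above merged g∈)) (subst T (sym (alive-inB {P} merged)) live)

  descend : ∀ P → Acc _⊂_ P → IsNonSingleton t P → g ∈ P → NoInputGate P → T (alive (inA P)) →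
            ∃[ z ] z ∈ˡ inputs* (orig g)
  descend P (acc smaller) merged g∈ no-input live with child-containing merged g∈
  ... | C , child , g∈C with proj₂ (child-operand child)
  ...   | inj₁ (w , refl) rewrite sym (x∈⁅y⁆⇒x≡y w g∈C) =
          inOut P , ∈-filterᵇ⁺ alive (parent∈inInputs child no-input) (live-output merged g∈ live)
  ...   | inj₂ merged-C =
          descend C (smaller (child⊂parent child)) merged-C g∈C (no-input-⊆ (proj₁ (child⊂parent child)) no-input)
                  (alive-from-input merged-C (parent∈inInputs child no-input) (live-output merged g∈ live))

  -- orig g has a live input: along the arc g′ → g and down to {g}
  live-input-of-g : ∃[ z ] z ∈ˡ inputs* (orig g)
  live-input-of-g with Equivalence.to (proj₂ (proj₂ scd) g′ g) g′→g
  ... | (S₁ , S₂) , arc , _ , g∈ with arc-from-g′ arc g∈ | proj₂ (proj₂ (arc-ok arc))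
  ...   | refl | inj₁ (w , refl) rewrite sym (x∈⁅y⁆⇒x≡y w g∈) =
          orig g′ , ∈-filterᵇ⁺ alive (subst (_∈ˡ inInputs ⁅ g ⁆) (source-g′ ⁅ g ⁆) (arc∈inInputs arc)) (alive-orig g′)
  ...   | refl | inj₂ merged =
          descend S₂ (⊂-wellFounded S₂) merged g∈ (arc-target-no-input arc)
                  (alive-from-input merged (arc∈inInputs arc) (subst (T ∘ alive) (sym (source-g′ S₂)) (alive-orig g′)))

  negates-input : value (orig g) ≡ not (value (orig g′))
  negates-input =
    negation ρ {orig g} tt (op-orig-not not-gate) (live-inputs-above (x∈⁅x⁆ g) parents-ok) live-input-of-g
    where
    parents-ok : ∀ {Q} → ChildOf ⁅ g ⁆ Q → T (alive (inA Q)) → value (inA Q) ≡ not (value (orig g′))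
    parents-ok child = inA-above _ (⊃-wellFounded _) (parent-union child) (proj₁ (child⊂parent child) (x∈⁅x⁆ g))

lemma7 : ∀ {n : ℕ} (F : Circuit n) (t : SCD n)
           (choice : Subset n → Subset n → Bool) →
           IsCircuit F → IsSCDOf F t → TypeRespecting F t →
           ∀ (g g' : Fin n) → kind F g ≡ notK → wire F g' g →
           ∀ (ρ : Fin n → Bool) →
           Construction.f F t choice (orig g) ρ
             ≡ not (Construction.f F t choice (orig g') ρ)
lemma7 {zero}  F t choice cF scd typed () g′ not-gate g′→g ρ
lemma7 {suc m} F t choice cF scd typed g  g′ not-gate g′→g ρ =
  NotGate.negates-input F t choice cF scd typed g g′ not-gate g′→g ρ
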